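{- For each pair of positive integers $j,k$ there is a number $m(j,k)$ such that for each integer $m\ge m(j,k)$, the fraction $m/(km+1)$ is not the sum of $j$ unit fractions, i.e. there are no positive integers $x_1,\dots,x_j$ with $\frac{m}{km+1}=\sum_{i=1}^j\frac1{x_i}$.
   Context: A unit fraction is a number $1/x$ with $x$ a positive integer; the summands need not be distinct. -}

module Defs where

open import Data.Nat using (ℕ; zero; suc; NonZero)
open import Data.Integer using (+_)
open import Data.Fin using (Fin; zero; suc)
open import Data.Rational using (ℚ; 0ℚ; _+_; _/_)

unitSum : (j : ℕ) (x : Fin j → ℕ) → ((i : Fin j) → NonZero (x i)) → ℚ
unitSum zero    x nz = 0ℚ
unitSum (suc j) x nz =
  ((+ 1) / x zero) {{nz zero}} + unitSum j (λ i → x (suc i)) (λ i → nz (suc i))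

{-# OPTIONS --safe #-}
-- A sum s of j unit fractions smaller than p/d falls short of it by at least 1/G, where G
-- depends only on j and d.  For j = 0 this is p/d ≥ 1/d.  Otherwise, if every denominator
-- exceeds 2jd then s ≤ 1/(2d) ≤ (p/d)/2; if some denominator x is at most 2jd, the other
-- j − 1 terms fall short of p/d − 1/x, whose denominator dx is at most 2jd², by induction.
-- Since m/(km+1) = 1/k − 1/(k(km+1)) falls short of 1/k by less than 1/m, it is not such a
-- sum once m ≥ G.
module Submission where

open import Defs
open import Algebra.Bundles using (CommutativeMonoid)
open import Data.Fin using (Fin; zero; suc; punchIn)
open import Data.Fin.Properties using (any?)
open import Data.Integer.Base as ℤ using (+_; +≤+; +<+)
import Data.Integer.Properties as ℤ
open import Data.List using (_∷_; [])
open import Data.Nat using (ℕ; zero; suc; pred; _+_; _*_; _∸_; _≤_; _<_; _<?_; NonZero; z≤n; s≤s)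
import Data.Nat.Properties as ℕ
open import Data.Nat.Tactic.RingSolver using (solve; solve-∀)
open import Data.Product using (Σ; _,_)
open import Data.Rational using (_/_; toℚᵘ)
open import Data.Rational.Properties using (toℚᵘ-fromℚᵘ; toℚᵘ-homo-+; toℚᵘ-cong)
open import Data.Rational.Unnormalised using (ℚᵘ; 0ℚᵘ; _≃_; *≤*; *<*; *≡*)
  renaming (_+_ to _+ᵘ_; _≤_ to _≤ᵘ_; _<_ to _<ᵘ_; _/_ to _/ᵘ_)
import Data.Rational.Unnormalised.Properties as ℚᵘ
open import Function using (_∘_)
open import Relation.Binary.PropositionalEquality
  using (_≡_; refl; sym; trans; cong; cong₂; subst; subst₂; module ≡-Reasoning)
open import Relation.Nullary using (¬_; yes; no; contradiction)

open import Algebra.Properties.CommutativeSemigroup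
  (CommutativeMonoid.commutativeSemigroup ℚᵘ.+-0-commutativeMonoid) using (x∙yz≈y∙xz)

cross-≤⇒≤ : ∀ {a b c d} → a * suc d ≤ b * suc c → + a /ᵘ suc c ≤ᵘ + b /ᵘ suc d
cross-≤⇒≤ {a} {b} {c} {d} ad≤bc =
  *≤* (subst₂ ℤ._≤_ (ℤ.pos-* a (suc d)) (ℤ.pos-* b (suc c)) (+≤+ ad≤bc))

≤⇒cross-≤ : ∀ {a b c d} → + a /ᵘ suc c ≤ᵘ + b /ᵘ suc d → a * suc d ≤ b * suc c
≤⇒cross-≤ {a} {b} {c} {d} (*≤* le) =
  ℤ.drop‿+≤+ (subst₂ ℤ._≤_ (sym (ℤ.pos-* a (suc d))) (sym (ℤ.pos-* b (suc c))) le)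

cross-<⇒< : ∀ {a b c d} → a * suc d < b * suc c → + a /ᵘ suc c <ᵘ + b /ᵘ suc d
cross-<⇒< {a} {b} {c} {d} ad<bc =
  *<* (subst₂ ℤ._<_ (ℤ.pos-* a (suc d)) (ℤ.pos-* b (suc c)) (+<+ ad<bc))

<⇒cross-< : ∀ {a b c d} → + a /ᵘ suc c <ᵘ + b /ᵘ suc d → a * suc d < b * suc c
<⇒cross-< {a} {b} {c} {d} (*<* lt) =
  ℤ.drop‿+<+ (subst₂ ℤ._<_ (sym (ℤ.pos-* a (suc d))) (sym (ℤ.pos-* b (suc c))) lt)

cross-≡⇒≃ : ∀ {a b c d} → a * suc d ≡ b * suc c → + a /ᵘ suc c ≃ + b /ᵘ suc d
cross-≡⇒≃ {a} {b} {c} {d} ad≡bc =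
  *≡* (trans (sym (ℤ.pos-* a (suc d))) (trans (cong +_ ad≡bc) (ℤ.pos-* b (suc c))))

fraction-sum : ∀ a b c d →
  + a /ᵘ suc c +ᵘ + b /ᵘ suc d ≡ + (a * suc d + b * suc c) /ᵘ (suc c * suc d)
fraction-sum a b c d = cong (λ n → n /ᵘ (suc c * suc d)) (begin
  + a ℤ.* + suc d ℤ.+ + b ℤ.* + suc c
    ≡⟨ cong₂ ℤ._+_ (sym (ℤ.pos-* a (suc d))) (sym (ℤ.pos-* b (suc c))) ⟩
  + (a * suc d) ℤ.+ + (b * suc c)
    ≡⟨ sym (ℤ.pos-+ (a * suc d) (b * suc c)) ⟩
  + (a * suc d + b * suc c) ∎)
  where open ≡-Reasoning

fraction-sum-≃ : ∀ a b c d {e f} → (a * suc d + b * suc c) * suc f ≡ e * (suc c * suc d) →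
  + a /ᵘ suc c +ᵘ + b /ᵘ suc d ≃ + e /ᵘ suc f
fraction-sum-≃ a b c d {e} {f} eq =
  subst (_≃ + e /ᵘ suc f) (sym (fraction-sum a b c d)) (cross-≡⇒≃ eq)

1/suc-antimono-≤ : ∀ {a b} → a ≤ b → + 1 /ᵘ suc b ≤ᵘ + 1 /ᵘ suc a
1/suc-antimono-≤ a≤b = cross-≤⇒≤ (ℕ.*-monoʳ-≤ 1 (s≤s a≤b))

1/suc-≤-positive : ∀ {R p r} → r ≤ R → 0ℚᵘ <ᵘ + p /ᵘ suc r → + 1 /ᵘ suc R ≤ᵘ + p /ᵘ suc r
1/suc-≤-positive {p = zero}  _   0<0 = contradiction (<⇒cross-< 0<0) (ℕ.<-irrefl refl)
1/suc-≤-positive {R} {suc p} {r} r≤R _ = cross-≤⇒≤ (begin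
  1 * suc r       ≡⟨ ℕ.*-identityˡ (suc r) ⟩
  suc r           ≤⟨ s≤s r≤R ⟩
  suc R           ≤⟨ ℕ.m≤m+n (suc R) (p * suc R) ⟩
  suc p * suc R   ∎)
  where open ℕ.≤-Reasoning

halves : ∀ R → + 1 /ᵘ suc (2 * R + 1) +ᵘ + 1 /ᵘ suc (2 * R + 1) ≃ + 1 /ᵘ suc R
halves R = fraction-sum-≃ 1 1 (2 * R + 1) (2 * R + 1) (solve (R ∷ []))

+ᵘ-cancelˡ-< : ∀ p {q r} → p +ᵘ q <ᵘ p +ᵘ r → q <ᵘ r
+ᵘ-cancelˡ-< p lt = ℚᵘ.≰⇒> (λ r≤q → ℚᵘ.<⇒≱ lt (ℚᵘ.+-monoʳ-≤ p r≤q))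

+ᵘ-cancelˡ-≤ : ∀ p {q r} → p +ᵘ q ≤ᵘ p +ᵘ r → q ≤ᵘ r
+ᵘ-cancelˡ-≤ p le = ℚᵘ.≮⇒≥ (λ r<q → ℚᵘ.<⇒≱ (ℚᵘ.+-monoʳ-< p r<q) le)

-- unitSumᵘ j y = Σᵢ 1/(yᵢ + 1).  Here and throughout, denominators are written as successors,
-- so that + a /ᵘ suc d is the constructor mkℚᵘ (+ a) d and needs no positivity proof.
unitSumᵘ : (j : ℕ) → (Fin j → ℕ) → ℚᵘ
unitSumᵘ zero    y = 0ℚᵘ
unitSumᵘ (suc j) y = + 1 /ᵘ suc (y zero) +ᵘ unitSumᵘ j (y ∘ suc)

toℚᵘ-/ : ∀ n d → toℚᵘ (n / suc d) ≃ n /ᵘ suc d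
toℚᵘ-/ n d = toℚᵘ-fromℚᵘ (n /ᵘ suc d)

toℚᵘ-1/ : ∀ x .{{_ : NonZero x}} → toℚᵘ (+ 1 / x) ≃ + 1 /ᵘ suc (pred x)
toℚᵘ-1/ (suc y) = toℚᵘ-/ (+ 1) y

toℚᵘ-unitSum : ∀ j x nz → toℚᵘ (unitSum j x nz) ≃ unitSumᵘ j (pred ∘ x)
toℚᵘ-unitSum zero    x nz = ℚᵘ.≃-refl
toℚᵘ-unitSum (suc j) x nz =
  ℚᵘ.≃-trans (toℚᵘ-homo-+ ((+ 1 / x zero) {{nz zero}}) (unitSum j (x ∘ suc) (nz ∘ suc)))
    (ℚᵘ.+-cong (toℚᵘ-1/ (x zero) {{nz zero}}) (toℚᵘ-unitSum j (x ∘ suc) (nz ∘ suc)))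

unitSumᵘ-nonNeg : ∀ j y → 0ℚᵘ ≤ᵘ unitSumᵘ j y
unitSumᵘ-nonNeg zero    y = ℚᵘ.≤-refl
unitSumᵘ-nonNeg (suc j) y = ℚᵘ.≤-respˡ-≃ (ℚᵘ.+-identityˡ 0ℚᵘ)
  (ℚᵘ.+-mono-≤ (cross-≤⇒≤ {0} {1} {0} {y zero} z≤n) (unitSumᵘ-nonNeg j (y ∘ suc)))

unitSumᵘ-punchIn : ∀ j y i →
  unitSumᵘ (suc j) y ≃ + 1 /ᵘ suc (y i) +ᵘ unitSumᵘ j (y ∘ punchIn i)
unitSumᵘ-punchIn j       y zero    = ℚᵘ.≃-refl
unitSumᵘ-punchIn (suc j) y (suc i) = begin
  1/y₀ +ᵘ unitSumᵘ (suc j) (y ∘ suc)  ≈⟨ ℚᵘ.+-congʳ 1/y₀ (unitSumᵘ-punchIn j (y ∘ suc) i) ⟩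
  1/y₀ +ᵘ (1/yᵢ +ᵘ rest)              ≈⟨ x∙yz≈y∙xz 1/y₀ 1/yᵢ rest ⟩
  1/yᵢ +ᵘ (1/y₀ +ᵘ rest)              ∎
  where
  open ℚᵘ.≃-Reasoning
  1/y₀ 1/yᵢ rest : ℚᵘ
  1/y₀ = + 1 /ᵘ suc (y zero)
  1/yᵢ = + 1 /ᵘ suc (y (suc i))
  rest = unitSumᵘ j (y ∘ suc ∘ punchIn i)

unitSumᵘ-≤ : ∀ j {N} y → (∀ i → N ≤ y i) → unitSumᵘ j y ≤ᵘ + j /ᵘ suc N
unitSumᵘ-≤ zero    y _      = cross-≤⇒≤ z≤n
unitSumᵘ-≤ (suc j) {N} y N≤y = begin
  + 1 /ᵘ suc (y zero) +ᵘ unitSumᵘ j (y ∘ suc)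
    ≤⟨ ℚᵘ.+-mono-≤ (1/suc-antimono-≤ (N≤y zero)) (unitSumᵘ-≤ j (y ∘ suc) (N≤y ∘ suc)) ⟩
  + 1 /ᵘ suc N +ᵘ + j /ᵘ suc N
    ≃⟨ fraction-sum-≃ 1 j N N (solve (j ∷ N ∷ [])) ⟩
  + suc j /ᵘ suc N ∎
  where open ℚᵘ.≤-Reasoning

unitSumᵘ-large : ∀ j R y → (∀ i → 2 * j * suc R ≤ y i) → unitSumᵘ j y ≤ᵘ + 1 /ᵘ suc (2 * R + 1)
unitSumᵘ-large j R y large = ℚᵘ.≤-trans (unitSumᵘ-≤ j y large) (cross-≤⇒≤ (begin
  j * suc (2 * R + 1)     ≡⟨ solve (j ∷ R ∷ []) ⟩
  2 * j * suc R           ≤⟨ ℕ.n≤1+n _ ⟩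
  suc (2 * j * suc R)     ≡⟨ ℕ.*-identityˡ _ ⟨
  1 * suc (2 * j * suc R) ∎))
  where open ℕ.≤-Reasoning

unitSumᵘ-large-gap : ∀ j R {p r} → r ≤ R → (y : Fin j → ℕ) → (∀ i → 2 * j * suc R ≤ y i) →
  0ℚᵘ <ᵘ + p /ᵘ suc r → unitSumᵘ j y +ᵘ + 1 /ᵘ suc (2 * R + 1) ≤ᵘ + p /ᵘ suc r
unitSumᵘ-large-gap j R {p} {r} r≤R y large 0<q = begin
  unitSumᵘ j y +ᵘ half  ≤⟨ ℚᵘ.+-monoˡ-≤ half (unitSumᵘ-large j R y large) ⟩
  half +ᵘ half          ≃⟨ halves R ⟩
  + 1 /ᵘ suc R          ≤⟨ 1/suc-≤-positive r≤R 0<q ⟩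
  + p /ᵘ suc r          ∎
  where
  open ℚᵘ.≤-Reasoning
  half : ℚᵘ
  half = + 1 /ᵘ suc (2 * R + 1)

split-unit : ∀ {p r y} → + 1 /ᵘ suc y <ᵘ + p /ᵘ suc r →
  + 1 /ᵘ suc y +ᵘ + (p * suc y ∸ suc r) /ᵘ (suc r * suc y) ≃ + p /ᵘ suc r
split-unit {p} {r} {y} 1/y<p/r = fraction-sum-≃ 1 e y (y + r * suc y) (begin
  (1 * (suc r * suc y) + e * suc y) * suc r  ≡⟨ regroup e r y ⟩
  (e + suc r) * (suc y * suc r)              ≡⟨ cong (_* (suc y * suc r)) e+r≡py ⟩
  p * suc y * (suc y * suc r)                ≡⟨ solve (p ∷ r ∷ y ∷ []) ⟩
  p * (suc y * (suc r * suc y))              ∎)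
  where
  open ≡-Reasoning
  e : ℕ
  e = p * suc y ∸ suc r
  e+r≡py : e + suc r ≡ p * suc y
  e+r≡py = ℕ.m∸n+n≡m (ℕ.<⇒≤ (subst (_< p * suc y) (ℕ.*-identityˡ (suc r)) (<⇒cross-< 1/y<p/r)))
  regroup : ∀ e r y → (1 * (suc r * suc y) + e * suc y) * suc r ≡ (e + suc r) * (suc y * suc r)
  regroup = solve-∀

-- The summand 2R + 1 serves the case where all denominators are large, the recursive call the
-- removal of a denominator below 2(j+1)(R+1); adding them is a cheap maximum.
gapBound : ℕ → ℕ → ℕ
gapBound zero    R = R
gapBound (suc j) R = (2 * R + 1) + gapBound j (suc R * (2 * suc j * suc R))

unitSumᵘ-gap : ∀ j R {p r} → r ≤ R → (y : Fin j → ℕ) → unitSumᵘ j y <ᵘ + p /ᵘ suc r →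
  unitSumᵘ j y +ᵘ + 1 /ᵘ suc (gapBound j R) ≤ᵘ + p /ᵘ suc r
unitSumᵘ-gap zero R r≤R y 0<q =
  ℚᵘ.≤-respˡ-≃ (ℚᵘ.≃-sym (ℚᵘ.+-identityˡ _)) (1/suc-≤-positive r≤R 0<q)
unitSumᵘ-gap (suc j) R {p} {r} r≤R y s<q with any? (λ i → y i <? 2 * suc j * suc R)
... | no ¬small = ℚᵘ.≤-trans
  (ℚᵘ.+-monoʳ-≤ (unitSumᵘ (suc j) y) (1/suc-antimono-≤ (ℕ.m≤m+n (2 * R + 1) _)))
  (unitSumᵘ-large-gap (suc j) R r≤R y (λ i → ℕ.≮⇒≥ (λ yᵢ<N → ¬small (i , yᵢ<N)))
    (ℚᵘ.≤-<-trans (unitSumᵘ-nonNeg (suc j) y) s<q))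
... | yes (i , yᵢ<N) = begin
  unitSumᵘ (suc j) y +ᵘ gap   ≃⟨ ℚᵘ.+-congˡ gap (unitSumᵘ-punchIn j y i) ⟩
  (1/yᵢ +ᵘ rest) +ᵘ gap       ≃⟨ ℚᵘ.+-assoc 1/yᵢ rest gap ⟩
  1/yᵢ +ᵘ (rest +ᵘ gap)       ≤⟨ ℚᵘ.+-monoʳ-≤ 1/yᵢ (ℚᵘ.≤-trans (ℚᵘ.+-monoʳ-≤ rest gap≤gap′) ih) ⟩
  1/yᵢ +ᵘ q′                  ≃⟨ split-unit 1/yᵢ<q ⟩
  + p /ᵘ suc r                ∎
  where
  open ℚᵘ.≤-Reasoning
  yᵢ R′ : ℕ
  yᵢ = y i
  R′ = suc R * (2 * suc j * suc R)
  gap 1/yᵢ rest q′ : ℚᵘ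
  gap  = + 1 /ᵘ suc (gapBound (suc j) R)
  1/yᵢ = + 1 /ᵘ suc yᵢ
  rest = unitSumᵘ j (y ∘ punchIn i)
  q′   = + (p * suc yᵢ ∸ suc r) /ᵘ (suc r * suc yᵢ)
  sum≃ : unitSumᵘ (suc j) y ≃ 1/yᵢ +ᵘ rest
  sum≃ = unitSumᵘ-punchIn j y i
  1/yᵢ<q : 1/yᵢ <ᵘ + p /ᵘ suc r
  1/yᵢ<q = ℚᵘ.≤-<-trans
    (ℚᵘ.≤-respˡ-≃ (ℚᵘ.+-identityʳ 1/yᵢ) (ℚᵘ.+-monoʳ-≤ 1/yᵢ (unitSumᵘ-nonNeg j (y ∘ punchIn i))))
    (ℚᵘ.<-respˡ-≃ sum≃ s<q)
  rest<q′ : rest <ᵘ q′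
  rest<q′ = +ᵘ-cancelˡ-< 1/yᵢ (ℚᵘ.<-respʳ-≃ (ℚᵘ.≃-sym (split-unit 1/yᵢ<q)) (ℚᵘ.<-respˡ-≃ sum≃ s<q))
  r′≤R′ : yᵢ + r * suc yᵢ ≤ R′
  r′≤R′ = ℕ.<⇒≤ (ℕ.*-mono-≤ (s≤s r≤R) yᵢ<N)
  ih : rest +ᵘ + 1 /ᵘ suc (gapBound j R′) ≤ᵘ q′
  ih = unitSumᵘ-gap j R′ r′≤R′ (y ∘ punchIn i) rest<q′
  gap≤gap′ : gap ≤ᵘ + 1 /ᵘ suc (gapBound j R′)
  gap≤gap′ = 1/suc-antimono-≤ (ℕ.m≤n+m (gapBound j R′) (2 * R + 1))

m/[km+1]<1/k : ∀ k m → + m /ᵘ suc (suc k * m) <ᵘ + 1 /ᵘ suc k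
m/[km+1]<1/k k m = cross-<⇒< (begin-strict
  m * suc k           ≡⟨ ℕ.*-comm m (suc k) ⟩
  suc k * m           <⟨ ℕ.n<1+n _ ⟩
  suc (suc k * m)     ≡⟨ ℕ.*-identityˡ _ ⟨
  1 * suc (suc k * m) ∎)
  where open ℕ.≤-Reasoning

m/[km+1]+1/[k[km+1]]≃1/k : ∀ k m →
  + m /ᵘ suc (suc k * m) +ᵘ + 1 /ᵘ (suc k * suc (suc k * m)) ≃ + 1 /ᵘ suc k
m/[km+1]+1/[k[km+1]]≃1/k k m =
  fraction-sum-≃ m 1 (suc k * m) (suc k * m + k * suc (suc k * m)) (solve (k ∷ m ∷ []))

m/[km+1]-gap⇒≤ : ∀ k m B →
  + m /ᵘ suc (suc k * m) +ᵘ + 1 /ᵘ suc B ≤ᵘ + 1 /ᵘ suc k → m ≤ B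
m/[km+1]-gap⇒≤ k m B gap≤1/k = ℕ.≤-pred (begin
  suc m                        ≤⟨ s≤s (ℕ.m≤m+n m (k * m)) ⟩
  suc (suc k * m)              ≤⟨ ℕ.m≤n*m _ (suc k) ⟩
  suc k * suc (suc k * m)      ≤⟨ ℕ.*-cancelˡ-≤ 1 (≤⇒cross-≤ 1/[B+1]≤1/[k[km+1]]) ⟩
  suc B                        ∎)
  where
  open ℕ.≤-Reasoning
  1/[B+1]≤1/[k[km+1]] : + 1 /ᵘ suc B ≤ᵘ + 1 /ᵘ (suc k * suc (suc k * m))
  1/[B+1]≤1/[k[km+1]] = +ᵘ-cancelˡ-≤ (+ m /ᵘ suc (suc k * m))
    (ℚᵘ.≤-respʳ-≃ (ℚᵘ.≃-sym (m/[km+1]+1/[k[km+1]]≃1/k k m)) gap≤1/k)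

m/[km+1]≄unitSumᵘ : ∀ j k m → gapBound j k < m → (y : Fin j → ℕ) →
  ¬ (+ m /ᵘ suc (suc k * m) ≃ unitSumᵘ j y)
m/[km+1]≄unitSumᵘ j k m B<m y m/[km+1]≃s = ℕ.<⇒≱ B<m (m/[km+1]-gap⇒≤ k m (gapBound j k)
  (ℚᵘ.≤-respˡ-≃ (ℚᵘ.+-congˡ _ (ℚᵘ.≃-sym m/[km+1]≃s))
    (unitSumᵘ-gap j k ℕ.≤-refl y (ℚᵘ.<-respˡ-≃ m/[km+1]≃s (m/[km+1]<1/k k m)))))

theorem1p4 : (j k : ℕ) → NonZero j → NonZero k →
    Σ ℕ (λ m₀ → (m : ℕ) → m₀ ≤ m →
      (x : Fin j → ℕ) → (nz : (i : Fin j) → NonZero (x i)) →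
        ¬ ((+ m) / suc (k * m) ≡ unitSum j x nz))
theorem1p4 j (suc k) _ _ = suc (gapBound j k) , λ m B<m x nz m/[km+1]≡sum →
  m/[km+1]≄unitSumᵘ j k m B<m (pred ∘ x)
    (ℚᵘ.≃-trans (ℚᵘ.≃-sym (toℚᵘ-/ (+ m) (suc k * m)))
      (ℚᵘ.≃-trans (toℚᵘ-cong m/[km+1]≡sum) (toℚᵘ-unitSum j x nz)))
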